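{- Let $q\ge2$, $m\ge1$, and let $F:\{0,\dots,q-1\}^m\to\mathbb{Z}$ with $F(0,\dots,0)=0$ satisfy $\sum_{j=1}^{m-1}F(nq^j)=0$ for all $n\in\mathbb{N}$. Let $b$ and $b_\lambda$ be as defined below. Let $\alpha\in\mathbb{N}$, $n_1\in\mathbb{N}$ and $0\le n_2<q^\alpha$. Then for all $\lambda>\alpha$, $$b_\lambda(n_1q^\alpha+n_2)=b_{\lambda-\alpha}(n_1)+b_\alpha(n_1q^\alpha+n_2),$$ and $$b(n_1q^\alpha+n_2)=b(n_1)+b_\alpha(n_1q^\alpha+n_2).$$
   Context: $\varepsilon_j(n)$ is the $j$-th base-$q$ digit of the nonnegative integer $n$, with $\varepsilon_j(n)=0$ for $j<0$; $F(n):=F(\varepsilon_{m-1}(n),\dots,\varepsilon_0(n))$. The digital function is $b(n)=\sum_{j\in\mathbb{Z}}F(\varepsilon_{j+m-1}(n),\dots,\varepsilon_j(n))$ and the truncated function is $b_\lambda(n)=\sum_{j\in\mathbb{Z},\,j<\lambda}F(\varepsilon_{j+m-1}(n),\dots,\varepsilon_j(n))$ for $\lambda\ge0$. -}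

module Defs where

open import Data.Nat using (ℕ; zero; suc; _+_; _*_; _∸_; _^_; NonZero)
open import Data.Nat.Properties using (m^n≢0)
open import Data.Nat.DivMod using (_/_; _mod_)
open import Data.Integer as ℤ using (ℤ; +_; -[1+_]; 0ℤ)
open import Data.Fin using (Fin; toℕ)
open import Data.Vec using (Vec; tabulate)

digit : (q : ℕ) → .{{_ : NonZero q}} → ℤ → ℕ → Fin q
digit q (+ j)    n = (_/_ n (q ^ j) {{m^n≢0 q j}}) mod q
digit q -[1+ _ ] n = 0 mod q

-- The window (ε_{j+m-1}(n), …, ε_j(n)) in the paper's argument order:
-- entry i (i = 0 … m-1) is ε_{j + (m-1-i)}(n).
window : (q m : ℕ) → .{{_ : NonZero q}} → ℤ → ℕ → Vec (Fin q) m
window q m j n = tabulate (λ i → digit q (j ℤ.+ + (m ∸ 1 ∸ toℕ i)) n)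

-- F(n) := F(ε_{m-1}(n), …, ε_0(n))
Fnum : (q m : ℕ) → .{{_ : NonZero q}} → (Vec (Fin q) m → ℤ) → ℕ → ℤ
Fnum q m F n = F (window q m 0ℤ n)

sumFrom : ℤ → ℕ → (ℤ → ℤ) → ℤ
sumFrom a zero    f = 0ℤ
sumFrom a (suc k) f = f a ℤ.+ sumFrom (a ℤ.+ + 1) k f

shiftSum : (q m : ℕ) → .{{_ : NonZero q}} → (Vec (Fin q) m → ℤ) → ℕ → ℤ
shiftSum q m F n = sumFrom (+ 1) (m ∸ 1) (λ j → Fnum q m F (n * q ^ ℤ.∣ j ∣))

-- b_λ(n) = Σ_{j < λ} F(ε_{j+m-1}(n), …, ε_j(n)).
-- Terms with j ≤ -m have all digits 0, hence vanish since F(0,…,0) = 0;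
-- so the sum is taken over -(m-1) ≤ j ≤ λ-1, i.e. λ + m - 1 terms.
bTrunc : (q m : ℕ) → .{{_ : NonZero q}} → (Vec (Fin q) m → ℤ) → ℕ → ℕ → ℤ
bTrunc q m F λ' n = sumFrom (ℤ.- (+ (m ∸ 1))) (λ' + (m ∸ 1)) (λ j → F (window q m j n))

-- b(n) = Σ_{j ∈ ℤ} F(…). For j ≥ n all digits of n at positions ≥ j vanish
-- (n < q^n), so the terms with j ≥ n are F(0,…,0) = 0; hence b(n) = b_n(n).
b : (q m : ℕ) → .{{_ : NonZero q}} → (Vec (Fin q) m → ℤ) → ℕ → ℤ
b q m F n = bTrunc q m F n n

zeroDigit : (q : ℕ) → .{{_ : NonZero q}} → Fin q
zeroDigit q = 0 mod q

module Submission where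

open import Defs
open import Data.Nat using (ℕ; zero; suc; z≤n; s≤s; _+_; _*_; _∸_; _^_; _%_; _≤_; _<_; _≤?_; NonZero)
open import Data.Nat.Properties
  using (m^n≢0; m*n≢0; m^n>0; ^-distribˡ-+-*; ^-monoʳ-≤; +-comm; +-assoc; +-identityʳ;
         *-monoˡ-≤; +-mono-≤-<; <-≤-trans; ≤-trans; <⇒≤; m≤n⇒∃[o]m+o≡n; ≰⇒>; m+n∸m≡n;
         m<n⇒0<n∸m; m≤m+n; m≤n+m; module ≤-Reasoning)
open import Data.Nat.DivMod
  using (_/_; _mod_; m*n%n≡0; m*n/n≡m; m<n⇒m/n≡0; /-congˡ; /-congʳ; m/n/o≡m/[n*o];
         m*n/o*n≡m/o; +-distrib-/-∣ˡ)
open import Data.Nat.Divisibility using (n∣m*n)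
open import Data.Nat.Solver using (module +-*-Solver)
open import Data.Integer using (ℤ; 0ℤ; +_; -_; -[1+_]; _⊖_) renaming (_+_ to _+ℤ_)
import Data.Integer.Properties as ℤ
open import Data.Fin using (Fin; toℕ)
open import Data.Fin.Properties using (toℕ-injective; toℕ-fromℕ<)
open import Data.Vec using (Vec; replicate)
open import Data.Vec.Properties using (tabulate-cong; tabulate-∘; map-const)
open import Data.Product using (_×_; _,_)
open import Function using (id; const)
open import Relation.Nullary using (yes; no)
open import Relation.Binary.PropositionalEquality
  using (_≡_; refl; sym; trans; cong; cong₂; module ≡-Reasoning)

-- Write  term X j = F(ε_{j+m-1}(X), …, ε_j(X)),  so that
--   b_λ(X) = Σ_{-(m-1) ≤ j < 0} term X j  +  Σ_{0 ≤ j < λ} term X j   (bTrunc-split).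
-- (1) Multiplying by q^k shifts the digits of n by k places (digit-scale), so the
--     window of n at position -k is the window of n·q^k at position 0.  Hence the
--     negative part of b(n) is Σ_{k=1}^{m-1} F(n q^k), which vanishes by hypothesis
--     (lowerSum-vanishes).
-- (2) For N = n₁ q^α + n₂ with n₂ < q^α, the digits of N at positions ≥ α are those
--     of n₁ (digit-high); splitting Σ_{0 ≤ j < α+d} at α gives
--     b_{α+d}(N) = b_d(n₁) + b_α(N)  (bTrunc-block).  Since n < q^n, b(n) = b_n(n) equals b_λ(n) for all
--     λ ≥ n, and the second claim follows from (2) with d large.

sumFrom-cong : ∀ {a a'} k {f f' : ℤ → ℤ} →
               (∀ i → f (a +ℤ + i) ≡ f' (a' +ℤ + i)) → sumFrom a k f ≡ sumFrom a' k f'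
sumFrom-cong         zero    p = refl
sumFrom-cong {a} {a'} (suc k) {f} {f'} p = cong₂ _+ℤ_ first (sumFrom-cong k rest)
  where
    first : f a ≡ f' a'
    first = trans (cong f (sym (ℤ.+-identityʳ a))) (trans (p 0) (cong f' (ℤ.+-identityʳ a')))
    rest : ∀ i → f (a +ℤ + 1 +ℤ + i) ≡ f' (a' +ℤ + 1 +ℤ + i)
    rest i = trans (cong f (ℤ.+-assoc a (+ 1) (+ i)))
                   (trans (p (suc i)) (cong f' (sym (ℤ.+-assoc a' (+ 1) (+ i)))))

sumFrom-zeros : ∀ a k → sumFrom a k (const 0ℤ) ≡ 0ℤ
sumFrom-zeros a zero    = refl
sumFrom-zeros a (suc k) = cong (0ℤ +ℤ_) (sumFrom-zeros (a +ℤ + 1) k)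

sumFrom-vanishes : ∀ {a} k {f : ℤ → ℤ} → (∀ i → f (a +ℤ + i) ≡ 0ℤ) → sumFrom a k f ≡ 0ℤ
sumFrom-vanishes {a} k p = trans (sumFrom-cong {a' = a} k {f' = const 0ℤ} p) (sumFrom-zeros a k)

sumFrom-++ : ∀ a k l f → sumFrom a (k + l) f ≡ sumFrom a k f +ℤ sumFrom (a +ℤ + k) l f
sumFrom-++ a zero l f = begin
  sumFrom a l f                 ≡⟨ cong (λ s → sumFrom s l f) (sym (ℤ.+-identityʳ a)) ⟩
  sumFrom (a +ℤ + 0) l f        ≡⟨ sym (ℤ.+-identityˡ _) ⟩
  0ℤ +ℤ sumFrom (a +ℤ + 0) l f  ∎
  where open ≡-Reasoning
sumFrom-++ a (suc k) l f = begin
  f a +ℤ sumFrom (a +ℤ + 1) (k + l) f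
    ≡⟨ cong (f a +ℤ_) (sumFrom-++ (a +ℤ + 1) k l f) ⟩
  f a +ℤ (sumFrom (a +ℤ + 1) k f +ℤ sumFrom (a +ℤ + 1 +ℤ + k) l f)
    ≡⟨ sym (ℤ.+-assoc (f a) _ _) ⟩
  sumFrom a (suc k) f +ℤ sumFrom (a +ℤ + 1 +ℤ + k) l f
    ≡⟨ cong (λ s → sumFrom a (suc k) f +ℤ sumFrom s l f) (ℤ.+-assoc a (+ 1) (+ k)) ⟩
  sumFrom a (suc k) f +ℤ sumFrom (a +ℤ + suc k) l f
    ∎
  where open ≡-Reasoning

sumFrom-reflect : ∀ k (f : ℤ → ℤ) → sumFrom (- + k) k f ≡ sumFrom (+ 1) k (λ j → f (- j))
sumFrom-reflect zero    f = refl
sumFrom-reflect (suc k) f = begin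
  f -[1+ k ] +ℤ sumFrom (-[1+ k ] +ℤ + 1) k f
    ≡⟨ cong (λ s → f -[1+ k ] +ℤ sumFrom s k f) (ℤ.⊖-≤ (s≤s z≤n)) ⟩
  f -[1+ k ] +ℤ sumFrom (- + k) k f
    ≡⟨ cong (f -[1+ k ] +ℤ_) (sumFrom-reflect k f) ⟩
  f -[1+ k ] +ℤ sumFrom (+ 1) k g
    ≡⟨ ℤ.+-comm (f -[1+ k ]) _ ⟩
  sumFrom (+ 1) k g +ℤ f -[1+ k ]
    ≡⟨ cong (sumFrom (+ 1) k g +ℤ_) (sym (ℤ.+-identityʳ _)) ⟩
  sumFrom (+ 1) k g +ℤ sumFrom (+ 1 +ℤ + k) 1 g
    ≡⟨ sym (sumFrom-++ (+ 1) k 1 g) ⟩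
  sumFrom (+ 1) (k + 1) g
    ≡⟨ cong (λ n → sumFrom (+ 1) n g) (+-comm k 1) ⟩
  sumFrom (+ 1) (suc k) g
    ∎
  where
    open ≡-Reasoning
    g : ℤ → ℤ
    g j = f (- j)

quotient-by-block : ∀ {Q} .{{_ : NonZero Q}} n₁ n₂ → n₂ < Q → (n₁ * Q + n₂) / Q ≡ n₁
quotient-by-block {Q} n₁ n₂ n₂<Q = begin
  (n₁ * Q + n₂) / Q    ≡⟨ +-distrib-/-∣ˡ n₂ (n∣m*n n₁) ⟩
  n₁ * Q / Q + n₂ / Q  ≡⟨ cong₂ _+_ (m*n/n≡m n₁ Q) (m<n⇒m/n≡0 n₂<Q) ⟩
  n₁ + 0               ≡⟨ +-identityʳ n₁ ⟩
  n₁                   ∎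
  where open ≡-Reasoning

n<q^n : ∀ {q} → 2 ≤ q → ∀ n → n < q ^ n
n<q^n q≥2 zero    = s≤s z≤n
n<q^n {zero}      ()  (suc n)
n<q^n {q@(suc _)} q≥2 (suc n) = begin-strict
  1 + n            <⟨ +-mono-≤-< (m^n>0 q n) (n<q^n q≥2 n) ⟩
  q ^ n + q ^ n    ≡⟨ cong (_+_ (q ^ n)) (sym (+-identityʳ (q ^ n))) ⟩
  2 * q ^ n        ≤⟨ *-monoˡ-≤ (q ^ n) q≥2 ⟩
  q * q ^ n        ∎
  where open ≤-Reasoning

module Digits (q : ℕ) .{{_ : NonZero q}} where
  private
    q^≢0 : ∀ j → NonZero (q ^ j)
    q^≢0 j = m^n≢0 q j
    q^*q^≢0 : ∀ i j → NonZero (q ^ i * q ^ j)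
    q^*q^≢0 i j = m*n≢0 (q ^ i) (q ^ j) {{q^≢0 i}} {{q^≢0 j}}

  multiple-mod : ∀ x → (x * q) mod q ≡ zeroDigit q
  multiple-mod x = toℕ-injective (begin
    toℕ ((x * q) mod q) ≡⟨ toℕ-fromℕ< _ ⟩
    (x * q) % q         ≡⟨ m*n%n≡0 x q ⟩
    0                   ≡⟨ sym (m*n%n≡0 0 q) ⟩
    0 % q               ≡⟨ sym (toℕ-fromℕ< _) ⟩
    toℕ (zeroDigit q)   ∎)
    where open ≡-Reasoning

  digit-negative : ∀ {t} n → 0 < t → digit q (- + t) n ≡ zeroDigit q
  digit-negative {suc t} n _ = refl

  digit-beyond : ∀ {λ₀ p X} → X < q ^ λ₀ → λ₀ ≤ p → digit q (+ p) X ≡ zeroDigit q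
  digit-beyond {p = p} X<q^λ₀ λ₀≤p =
    cong (_mod q) (m<n⇒m/n≡0 {{q^≢0 p}} (<-≤-trans X<q^λ₀ (^-monoʳ-≤ q λ₀≤p)))

  digit-scaled-high : ∀ k d n → digit q (+ (k + d)) (n * q ^ k) ≡ digit q (+ d) n
  digit-scaled-high k d n = cong (_mod q) (begin
    n * q ^ k / q ^ (k + d)      ≡⟨ /-congʳ (trans (cong (q ^_) (+-comm k d)) (^-distribˡ-+-* q d k)) ⟩
    n * q ^ k / (q ^ d * q ^ k)  ≡⟨ m*n/o*n≡m/o n (q ^ k) (q ^ d) ⟩
    n / q ^ d                    ∎)
    where
      open ≡-Reasoning
      instance
        q^d≢0 = q^≢0 d
        q^k+d≢0 = q^≢0 (k + d)
        q^d*q^k≢0 = q^*q^≢0 d k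

  digit-scaled-low : ∀ {d k} n → d < k → digit q (+ d) (n * q ^ k) ≡ zeroDigit q
  digit-scaled-low {d} n d<k with m≤n⇒∃[o]m+o≡n d<k
  ... | t , refl = trans (cong (_mod q) quotient) (multiple-mod (n * q ^ t))
    where
      open +-*-Solver
      instance q^d≢0 = q^≢0 d
      regroup : n * q ^ (suc d + t) ≡ n * q ^ t * q * q ^ d
      regroup = trans (cong (n *_) (^-distribˡ-+-* q (suc d) t))
        (solve 4 (λ n q a b → n :* ((q :* a) :* b) := n :* b :* q :* a) refl n q (q ^ d) (q ^ t))
      quotient : n * q ^ (suc d + t) / q ^ d ≡ n * q ^ t * q
      quotient = trans (/-congˡ {o = q ^ d} regroup) (m*n/n≡m (n * q ^ t * q) (q ^ d))

  digit-scale : ∀ c k n → digit q (c ⊖ k) n ≡ digit q (+ c) (n * q ^ k)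
  digit-scale c k n with k ≤? c
  ... | no k≰c = trans (cong (λ j → digit q j n) (ℤ.⊖-< c<k))
                       (trans (digit-negative n (m<n⇒0<n∸m c<k)) (sym (digit-scaled-low n c<k)))
    where c<k = ≰⇒> k≰c
  ... | yes k≤c with m≤n⇒∃[o]m+o≡n k≤c
  ...   | d , refl = trans (cong (λ j → digit q j n) (trans (ℤ.⊖-≥ k≤c) (cong +_ (m+n∸m≡n k d))))
                           (sym (digit-scaled-high k d n))

  digit-high : ∀ α p n₁ {n₂} → n₂ < q ^ α →
               digit q (+ (α + p)) (n₁ * q ^ α + n₂) ≡ digit q (+ p) n₁
  digit-high α p n₁ {n₂} n₂<q^α = cong (_mod q) (begin
    N / q ^ (α + p)       ≡⟨ /-congʳ (^-distribˡ-+-* q α p) ⟩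
    N / (q ^ α * q ^ p)   ≡⟨ sym (m/n/o≡m/[n*o] N (q ^ α) (q ^ p)) ⟩
    N / q ^ α / q ^ p     ≡⟨ /-congˡ {o = q ^ p} (quotient-by-block n₁ n₂ n₂<q^α) ⟩
    n₁ / q ^ p            ∎)
    where
      open ≡-Reasoning
      N = n₁ * q ^ α + n₂
      instance
        q^α≢0 = q^≢0 α
        q^p≢0 = q^≢0 p
        q^α+p≢0 = q^≢0 (α + p)
        q^α*q^p≢0 = q^*q^≢0 α p

  window-cong : ∀ m j j' X Y → (∀ c → digit q (j +ℤ + c) X ≡ digit q (j' +ℤ + c) Y) →
                window q m j X ≡ window q m j' Y
  window-cong m j j' X Y same = tabulate-cong (λ i → same _)

  window-beyond : ∀ m {λ₀ p X} → X < q ^ λ₀ → λ₀ ≤ p →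
                  window q m (+ p) X ≡ replicate m (zeroDigit q)
  window-beyond m {p = p} X<q^λ₀ λ₀≤p =
    trans (tabulate-cong (λ i → digit-beyond X<q^λ₀ (≤-trans λ₀≤p (m≤m+n p _))))
          (trans (tabulate-∘ (const (zeroDigit q)) id) (map-const _ (zeroDigit q)))

module Decomposition (q m : ℕ) .{{_ : NonZero q}} (F : Vec (Fin q) m → ℤ)
                     (F-zero : F (replicate m (zeroDigit q)) ≡ 0ℤ)
                     (shift-free : ∀ n → shiftSum q m F n ≡ 0ℤ) where
  open Digits q
  open ≡-Reasoning

  B : ℕ → ℕ → ℤ
  B = bTrunc q m F

  M : ℕ
  M = m ∸ 1

  term : ℕ → ℤ → ℤ
  term X j = F (window q m j X)

  lowerSum : ℕ → ℤ
  lowerSum X = sumFrom (- + M) M (term X)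

  upperSum : ℕ → ℕ → ℤ
  upperSum λ' X = sumFrom 0ℤ λ' (term X)

  bTrunc-split : ∀ λ' X → B λ' X ≡ lowerSum X +ℤ upperSum λ' X
  bTrunc-split λ' X = begin
    sumFrom (- + M) (λ' + M) (term X)
      ≡⟨ cong (λ k → sumFrom (- + M) k (term X)) (+-comm λ' M) ⟩
    sumFrom (- + M) (M + λ') (term X)
      ≡⟨ sumFrom-++ (- + M) M λ' (term X) ⟩
    lowerSum X +ℤ sumFrom (- + M +ℤ + M) λ' (term X)
      ≡⟨ cong (λ a → lowerSum X +ℤ sumFrom a λ' (term X)) (ℤ.+-inverseˡ (+ M)) ⟩
    lowerSum X +ℤ upperSum λ' X
      ∎

  -- (1) The window of n at position -k is the window of n q^k at position 0, so the
  -- negative part of b(n) is Σ_{k=1}^{m-1} F(n q^k) = 0.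
  lowerSum-vanishes : ∀ n → lowerSum n ≡ 0ℤ
  lowerSum-vanishes n = begin
    lowerSum n                             ≡⟨ sumFrom-reflect M (term n) ⟩
    sumFrom (+ 1) M (λ j → term n (- j))   ≡⟨ sumFrom-cong M (λ i → cong F (scaled-window (suc i))) ⟩
    shiftSum q m F n                       ≡⟨ shift-free n ⟩
    0ℤ                                     ∎
    where
      shifted : ∀ k c → digit q (- + k +ℤ + c) n ≡ digit q (+ c) (n * q ^ k)
      shifted k c = trans (cong (λ j → digit q j n) (ℤ.-m+n≡n⊖m k c)) (digit-scale c k n)
      scaled-window : ∀ k → window q m (- + k) n ≡ window q m 0ℤ (n * q ^ k)
      scaled-window k = window-cong m (- + k) 0ℤ n (n * q ^ k) (shifted k)

  term-beyond : ∀ {λ₀ p X} → X < q ^ λ₀ → λ₀ ≤ p → term X (+ p) ≡ 0ℤ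
  term-beyond X<q^λ₀ λ₀≤p = trans (cong F (window-beyond m X<q^λ₀ λ₀≤p)) F-zero

  bTrunc-stable : ∀ {λ₀ λ' X} → λ₀ ≤ λ' → X < q ^ λ₀ → B λ' X ≡ B λ₀ X
  bTrunc-stable {λ₀} {X = X} λ₀≤λ' X<q^λ₀ with m≤n⇒∃[o]m+o≡n λ₀≤λ'
  ... | e , refl = begin
    B (λ₀ + e) X
      ≡⟨ bTrunc-split (λ₀ + e) X ⟩
    lowerSum X +ℤ upperSum (λ₀ + e) X
      ≡⟨ cong (lowerSum X +ℤ_) (sumFrom-++ 0ℤ λ₀ e (term X)) ⟩
    lowerSum X +ℤ (upperSum λ₀ X +ℤ sumFrom (+ λ₀) e (term X))
      ≡⟨ cong (λ s → lowerSum X +ℤ (upperSum λ₀ X +ℤ s))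
              (sumFrom-vanishes e (λ i → term-beyond X<q^λ₀ (m≤m+n λ₀ i))) ⟩
    lowerSum X +ℤ (upperSum λ₀ X +ℤ 0ℤ)
      ≡⟨ cong (lowerSum X +ℤ_) (ℤ.+-identityʳ _) ⟩
    lowerSum X +ℤ upperSum λ₀ X
      ≡⟨ sym (bTrunc-split λ₀ X) ⟩
    B λ₀ X
      ∎

  bTrunc-block : ∀ α d n₁ {n₂} → n₂ < q ^ α →
                 B (α + d) (n₁ * q ^ α + n₂) ≡ B d n₁ +ℤ B α (n₁ * q ^ α + n₂)
  bTrunc-block α d n₁ {n₂} n₂<q^α = begin
    B (α + d) N
      ≡⟨ bTrunc-split (α + d) N ⟩
    lowerSum N +ℤ upperSum (α + d) N
      ≡⟨ cong (lowerSum N +ℤ_) (sumFrom-++ 0ℤ α d (term N)) ⟩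
    lowerSum N +ℤ (upperSum α N +ℤ sumFrom (+ α) d (term N))
      ≡⟨ cong (λ s → lowerSum N +ℤ (upperSum α N +ℤ s)) high-part ⟩
    lowerSum N +ℤ (upperSum α N +ℤ upperSum d n₁)
      ≡⟨ sym (ℤ.+-assoc (lowerSum N) _ _) ⟩
    (lowerSum N +ℤ upperSum α N) +ℤ upperSum d n₁
      ≡⟨ cong₂ _+ℤ_ (sym (bTrunc-split α N)) (sym (ℤ.+-identityˡ _)) ⟩
    B α N +ℤ (0ℤ +ℤ upperSum d n₁)
      ≡⟨ cong (λ s → B α N +ℤ (s +ℤ upperSum d n₁)) (sym (lowerSum-vanishes n₁)) ⟩
    B α N +ℤ (lowerSum n₁ +ℤ upperSum d n₁)
      ≡⟨ cong (B α N +ℤ_) (sym (bTrunc-split d n₁)) ⟩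
    B α N +ℤ B d n₁
      ≡⟨ ℤ.+-comm (B α N) (B d n₁) ⟩
    B d n₁ +ℤ B α N
      ∎
    where
      N = n₁ * q ^ α + n₂
      -- positions α, α+1, … of N carry the digits of n₁
      high-part : sumFrom (+ α) d (term N) ≡ upperSum d n₁
      high-part = sumFrom-cong d (λ i → cong F (window-cong m (+ (α + i)) (+ i) N n₁ (λ c →
        trans (cong (λ p → digit q (+ p) N) (+-assoc α i c)) (digit-high α (i + c) n₁ n₂<q^α))))

lemma3 : (q m : ℕ) → .{{_ : NonZero q}} → 2 ≤ q → 1 ≤ m →
         (F : Vec (Fin q) m → ℤ) →
         F (replicate m (zeroDigit q)) ≡ 0ℤ →
         (∀ n → shiftSum q m F n ≡ 0ℤ) →
         (α n₁ n₂ : ℕ) → n₂ < q ^ α →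
         (∀ λ' → α < λ' →
            bTrunc q m F λ' (n₁ * q ^ α + n₂)
              ≡ bTrunc q m F (λ' ∸ α) n₁ +ℤ bTrunc q m F α (n₁ * q ^ α + n₂))
         × (b q m F (n₁ * q ^ α + n₂) ≡ b q m F n₁ +ℤ bTrunc q m F α (n₁ * q ^ α + n₂))
lemma3 q m q≥2 _ F F-zero shift-free α n₁ n₂ n₂<q^α = truncated , full
  where
    open Decomposition q m F F-zero shift-free
    open ≡-Reasoning
    N = n₁ * q ^ α + n₂

    truncated : ∀ λ' → α < λ' → B λ' N ≡ B (λ' ∸ α) n₁ +ℤ B α N
    truncated λ' α<λ' with m≤n⇒∃[o]m+o≡n (<⇒≤ α<λ')
    ... | d , refl = trans (bTrunc-block α d n₁ n₂<q^α)
                           (cong (λ k → B k n₁ +ℤ B α N) (sym (m+n∸m≡n α d)))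

    -- b = b_λ for any λ beyond the number of digits; take λ = α + (n₁ + N).
    full : B N N ≡ B n₁ n₁ +ℤ B α N
    full = begin
      B N N                      ≡⟨ sym (bTrunc-stable (≤-trans (m≤n+m N n₁) (m≤n+m _ α)) (n<q^n q≥2 N)) ⟩
      B (α + (n₁ + N)) N         ≡⟨ bTrunc-block α (n₁ + N) n₁ n₂<q^α ⟩
      B (n₁ + N) n₁ +ℤ B α N     ≡⟨ cong (_+ℤ B α N) (bTrunc-stable (m≤m+n n₁ N) (n<q^n q≥2 n₁)) ⟩
      B n₁ n₁ +ℤ B α N           ∎
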